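{- Let $x_{\text{jopt}}$ and $x_{\text{mopt}}$ be the job-optimal and the machine-optimal relaxed unsplit stable assignments of an instance, and let $m$ be a machine. (i) If $x_{\text{mopt}}(m)<q(m)$, then $x(m)<q(m)$ for every relaxed unsplit stable assignment $x$. (ii) If $x_{\text{jopt}}(m)>q(m)$, then $x(m)\ge q(m)$ for every relaxed unsplit stable assignment $x$.
   Context: An instance consists of a finite bipartite graph $G=(J\cup M,E)$ between jobs $J$ and machines $M$; each job $j$ has size $q(j)>0$, each machine $m$ capacity $q(m)>0$; each job strictly ranks its adjacent machines and each machine strictly ranks its adjacent jobs. $M$ contains a dummy machine $m_d$ adjacent to every job, ranked last by every job, with $q(m_d)>\sum_{j\in J}q(j)$. An assignment is $x:E\to\mathbb{R}_{\ge0}$, $x(j)=\sum_m x(jm)$, $x(m)=\sum_j x(jm)$. It is unsplit if $x(jm)\in\{0,q(j)\}$ for all $jm$ and $x(j)\le q(j)$ for all $j$. An unsplit $x$ is a relaxed unsplit assignment if for every machine $m$ with at least one assigned job, $x(m)-q(j_m)<q(m)$, where $j_m$ is the assigned job $m$ likes least. A relaxed unsplit assignment $x$ is stable if for every edge $jm$ with $x(jm)=0$, either $j$ is assigned to a machine it prefers to $m$, or $\sum_{j':m\text{ prefers } j'\text{ to } j}x(j'm)\ge q(m)$. For unsplit $x_1,x_2$: job $j$ weakly prefers $x_1$ to $x_2$ if its machine in $x_1$ is equal to or preferred by $j$ to its machine in $x_2$; machine $m$ weakly prefers $x_1$ to $x_2$ if either no edge incident to $m$ is positive in exactly one of $x_1,x_2$,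 or the edge $m$ ranks best among those incident edges positive in exactly one of them is positive in $x_1$. The job-optimal (machine-optimal) relaxed unsplit stable assignment $x_{\text{jopt}}$ ($x_{\text{mopt}}$) is the (existing) relaxed unsplit stable assignment that every job (machine) weakly prefers to every relaxed unsplit stable assignment.
   Formalization: The job sizes $q(j)$, the machine capacities $q(m)$ and the assignment values are rational numbers rather than real numbers. -}

module Defs where

open import Data.Nat as ℕ using (ℕ; zero; suc)
open import Data.Fin using (Fin; zero; suc)
open import Data.Bool using (Bool; true; false; if_then_else_)
open import Data.Rational using (ℚ; 0ℚ; _+_; _-_; _<_; _≤_)
open import Data.Product using (_×_; Σ; ∃-syntax; _,_)
open import Data.Sum using (_⊎_)
open import Relation.Binary.PropositionalEquality using (_≡_; _≢_)
open import Relation.Nullary using (¬_)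

sumFin : (n : ℕ) → (Fin n → ℚ) → ℚ
sumFin zero    f = 0ℚ
sumFin (suc n) f = f zero + sumFin n (λ i → f (suc i))

-- Preferences are strict rankings given by rank functions (smaller rank = preferred),
-- injective on the adjacent vertices.
record Instance : Set where
  field
    nJ nM     : ℕ
    adj       : Fin nJ → Fin nM → Bool
    qJ        : Fin nJ → ℚ
    qM        : Fin nM → ℚ
    qJ-pos    : ∀ j → 0ℚ < qJ j
    qM-pos    : ∀ m → 0ℚ < qM m
    rankJ     : Fin nJ → Fin nM → ℕ
    rankM     : Fin nM → Fin nJ → ℕ
    rankJ-inj : ∀ j m m′ → adj j m ≡ true → adj j m′ ≡ true →
                rankJ j m ≡ rankJ j m′ → m ≡ m′
    rankM-inj : ∀ m j j′ → adj j m ≡ true → adj j′ m ≡ true →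
                rankM m j ≡ rankM m j′ → j ≡ j′
    md        : Fin nM
    md-adj    : ∀ j → adj j md ≡ true
    md-last   : ∀ j m → adj j m ≡ true → m ≢ md → rankJ j m ℕ.< rankJ j md
    md-cap    : sumFin nJ qJ < qM md

module _ (I : Instance) where
  open Instance I

  Assignment : Set
  Assignment = Fin nJ → Fin nM → ℚ

  loadJ : Assignment → Fin nJ → ℚ
  loadJ x j = sumFin nM (λ m → x j m)

  loadM : Assignment → Fin nM → ℚ
  loadM x m = sumFin nJ (λ j → x j m)

  -- x : E → ℝ≥0, represented as a function vanishing off E
  IsAssignment : Assignment → Set
  IsAssignment x = (∀ j m → 0ℚ ≤ x j m) × (∀ j m → adj j m ≡ false → x j m ≡ 0ℚ)

  Unsplit : Assignment → Set
  Unsplit x = IsAssignment x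
            × (∀ j m → adj j m ≡ true → (x j m ≡ 0ℚ ⊎ x j m ≡ qJ j))
            × (∀ j → loadJ x j ≤ qJ j)

  RelaxedUnsplit : Assignment → Set
  RelaxedUnsplit x = Unsplit x
    × (∀ m j → 0ℚ < x j m →
         (∀ j′ → 0ℚ < x j′ m → rankM m j′ ℕ.≤ rankM m j) →
         loadM x m - qJ j < qM m)

  betterLoad : Assignment → Fin nM → Fin nJ → ℚ
  betterLoad x m j =
    sumFin nJ (λ j′ → if rankM m j′ ℕ.<ᵇ rankM m j then x j′ m else 0ℚ)

  Stable : Assignment → Set
  Stable x = RelaxedUnsplit x
    × (∀ j m → adj j m ≡ true → x j m ≡ 0ℚ →
         (∃[ m′ ] (0ℚ < x j m′ × rankJ j m′ ℕ.< rankJ j m))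
         ⊎ (qM m ≤ betterLoad x m j))

  JobWeaklyPrefers : Assignment → Assignment → Fin nJ → Set
  JobWeaklyPrefers x₁ x₂ j =
    ∀ m₁ m₂ → 0ℚ < x₁ j m₁ → 0ℚ < x₂ j m₂ → rankJ j m₁ ℕ.≤ rankJ j m₂

  PosInExactlyOne : Assignment → Assignment → Fin nJ → Fin nM → Set
  PosInExactlyOne x₁ x₂ j m =
    (0ℚ < x₁ j m × ¬ (0ℚ < x₂ j m)) ⊎ (¬ (0ℚ < x₁ j m) × 0ℚ < x₂ j m)

  MachineWeaklyPrefers : Assignment → Assignment → Fin nM → Set
  MachineWeaklyPrefers x₁ x₂ m =
    ∀ j → PosInExactlyOne x₁ x₂ j m →
      (∀ j′ → PosInExactlyOne x₁ x₂ j′ m → rankM m j ℕ.≤ rankM m j′) →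
      0ℚ < x₁ j m

  JobOptimal : Assignment → Set
  JobOptimal x = Stable x × (∀ y → Stable y → ∀ j → JobWeaklyPrefers x y j)

  MachineOptimal : Assignment → Set
  MachineOptimal x = Stable x × (∀ y → Stable y → ∀ m → MachineWeaklyPrefers x y m)

-- Machine-proposing deferred acceptance, where a job holding two proposals
-- rejects the worse one, yields a stable assignment w that every job likes
-- least among the stable ones. If machine m is under capacity in a stable x,
-- a job k missing from m in x although it does not prefer its x-machine to m
-- would need the jobs m prefers to k to fill q(m); so such jobs are at m in x.
-- Applied to the jobs of x_jopt at m this gives (ii). For (i), machine
-- optimality of x_mopt against w puts all of w's jobs at m into x_mopt (the
-- first disagreement in m's order would break the relaxed capacity bound of
-- x_mopt), hence w(m) <= x_mopt(m) < q(m), and the first argument applied to w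
-- gives x(m) <= w(m) for every stable x.
module Submission where

open import Defs
open import Data.Product using (_×_)
open import Data.Rational using (_<_; _≤_)
open import Data.Fin using (Fin)

import Data.Nat.Properties as ℕP
import Data.Rational.Properties as ℚP
open import Algebra.Properties.CommutativeMonoid.Sum ℚP.+-0-commutativeMonoid
  using (sum; sum-cong-≗; ∑-distrib-+; sum-remove; sum-replicate-zero)
open import Algebra.Properties.Group ℚP.+-0-group using (//-rightDividesʳ)
open import Algebra.Properties.Monoid.Sum ℕP.+-0-monoid using () renaming (sum to sumℕ)
open import Data.Bool as Bool using (Bool; true; false; if_then_else_)
open import Data.Empty using (⊥-elim)
open import Data.Fin using (zero; suc; punchIn)
open import Data.Fin.Properties using (_≟_; punchInᵢ≢i; any?)
open import Data.List.Base using (List; allFin; filter)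
open import Data.List.Extrema.Nat
  using (argmin; argmax; f[argmin]≤f[xs]; f[xs]≤f[argmax]; argmin-all; argmax-all)
open import Data.List.Membership.Propositional using (_∈_)
open import Data.List.Membership.Propositional.Properties using (∈-filter⁺; ∈-allFin)
import Data.List.Relation.Unary.All as All
open import Data.List.Relation.Unary.All.Properties using (all-filter)
open import Data.Nat as ℕ using (ℕ; zero; suc)
open import Data.Nat.Induction using (<-wellFounded)
open import Data.Product using (∃-syntax; _,_; proj₁; proj₂)
open import Data.Rational as ℚ using (ℚ; 0ℚ; _+_; _-_)
open import Data.Sum using (_⊎_; inj₁; inj₂; [_,_]′)
open import Data.Vec.Functional using (removeAt; updateAt)
open import Data.Vec.Functional.Properties using (updateAt-updates; updateAt-minimal)
open import Function using (_on_; case_of_)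
open import Induction.WellFounded using (Acc; acc)
import Relation.Binary.Construct.On as On
open import Relation.Binary.Definitions using (tri<; tri≈; tri>)
open import Relation.Binary.PropositionalEquality
open import Relation.Nullary using (¬_; ¬?; Dec; yes; no; does; ofʸ; ofⁿ)
open import Relation.Nullary.Decidable using (_×-dec_; _⊎-dec_; decidable-stable)
open import Relation.Unary using (Pred; Decidable)

module _ {n p} {P : Pred (Fin n) p} (P? : Decidable P) (f : Fin n → ℕ) where

  private
    candidates : List (Fin n)
    candidates = filter P? (allFin n)

    candidate : ∀ {i} → P i → i ∈ candidates
    candidate = ∈-filter⁺ P? (∈-allFin _)

  minimiser : ∀ {i} → P i → ∃[ k ] (P k × (∀ i → P i → f k ℕ.≤ f i))
  minimiser {i} pi = argmin f i candidates
                   , argmin-all f pi (all-filter P? (allFin n))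
                   , λ _ pi′ → All.lookup (f[argmin]≤f[xs] i candidates) (candidate pi′)

  maximiser : ∀ {i} → P i → ∃[ k ] (P k × (∀ i → P i → f i ℕ.≤ f k))
  maximiser {i} pi = argmax f i candidates
                   , argmax-all f pi (all-filter P? (allFin n))
                   , λ _ pi′ → All.lookup (f[xs]≤f[argmax] i candidates) (candidate pi′)

when : ∀ {p} {P : Set p} → Dec P → ℚ → ℚ
when P? v = if does P? then v else 0ℚ

module _ {p} {P : Set p} {v : ℚ} where

  when-yes : (P? : Dec P) → P → when P? v ≡ v
  when-yes P? p with P?
  ... | yes _ = refl
  ... | no ¬p = ⊥-elim (¬p p)

  when-no : (P? : Dec P) → ¬ P → when P? v ≡ 0ℚ
  when-no P? ¬p with P?
  ... | yes p = ⊥-elim (¬p p)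
  ... | no  _ = refl

  when-pos⇒ : (P? : Dec P) → 0ℚ < when P? v → P
  when-pos⇒ P? pos with P?
  ... | yes p = p
  ... | no  _ = ⊥-elim (ℚP.<-irrefl refl pos)

  when-nonneg : (P? : Dec P) → 0ℚ ≤ v → 0ℚ ≤ when P? v
  when-nonneg P? v≥0 with P?
  ... | yes _ = v≥0
  ... | no  _ = ℚP.≤-refl

  when-≤ : (P? : Dec P) → 0ℚ ≤ v → when P? v ≤ v
  when-≤ P? v≥0 with P?
  ... | yes _ = ℚP.≤-refl
  ... | no  _ = v≥0

  when-mono : ∀ {q} {Q : Set q} (P? : Dec P) (Q? : Dec Q) → (P → Q) → 0ℚ ≤ v →
              when P? v ≤ when Q? v
  when-mono P? Q? P⇒Q v≥0 with P? | Q?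
  ... | yes p | no ¬q = ⊥-elim (¬q (P⇒Q p))
  ... | yes _ | yes _ = ℚP.≤-refl
  ... | no  _ | yes _ = v≥0
  ... | no  _ | no  _ = ℚP.≤-refl

sumFin≡sum : ∀ n (f : Fin n → ℚ) → sumFin n f ≡ sum f
sumFin≡sum zero    f = refl
sumFin≡sum (suc n) f = cong (f zero +_) (sumFin≡sum n (λ i → f (suc i)))

sumFin-mono : ∀ n {f g : Fin n → ℚ} → (∀ i → f i ≤ g i) → sumFin n f ≤ sumFin n g
sumFin-mono zero    f≤g = ℚP.≤-refl
sumFin-mono (suc n) f≤g = ℚP.+-mono-≤ (f≤g zero) (sumFin-mono n (λ i → f≤g (suc i)))

sumFin-+ : ∀ n (f g : Fin n → ℚ) → sumFin n (λ i → f i + g i) ≡ sumFin n f + sumFin n g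
sumFin-+ n f g = begin
  sumFin n (λ i → f i + g i)  ≡⟨ sumFin≡sum n _ ⟩
  sum (λ i → f i + g i)       ≡⟨ ∑-distrib-+ f g ⟩
  sum f + sum g               ≡⟨ sym (cong₂ _+_ (sumFin≡sum n f) (sumFin≡sum n g)) ⟩
  sumFin n f + sumFin n g     ∎
  where open ≡-Reasoning

sumFin-single : ∀ n {f : Fin n → ℚ} i → (∀ k → k ≢ i → f k ≡ 0ℚ) → sumFin n f ≡ f i
sumFin-single (suc n) {f} i vanish = begin
  sumFin (suc n) f          ≡⟨ sumFin≡sum (suc n) f ⟩
  sum f                     ≡⟨ sum-remove f ⟩
  f i + sum (removeAt f i)  ≡⟨ cong (f i +_) (trans (sum-cong-≗ rest≡0) (sum-replicate-zero n)) ⟩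
  f i + 0ℚ                  ≡⟨ ℚP.+-identityʳ (f i) ⟩
  f i                       ∎
  where
  open ≡-Reasoning
  rest≡0 : ∀ k → removeAt f i k ≡ 0ℚ
  rest≡0 k = vanish (punchIn i k) (punchInᵢ≢i i k)

sumFin-≥-pair : ∀ n {f : Fin n → ℚ} {i i′} → (∀ k → 0ℚ ≤ f k) → i ≢ i′ →
                f i + f i′ ≤ sumFin n f
sumFin-≥-pair n {f} {i} {i′} f≥0 i≢i′ = begin
  f i + f i′                              ≡⟨ sym (cong₂ _+_ (sumFin-only i) (sumFin-only i′)) ⟩
  sumFin n (only i) + sumFin n (only i′)  ≡⟨ sym (sumFin-+ n (only i) (only i′)) ⟩
  sumFin n (λ k → only i k + only i′ k)   ≤⟨ sumFin-mono n both≤f ⟩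
  sumFin n f                              ∎
  where
  open ℚP.≤-Reasoning
  only : Fin n → Fin n → ℚ
  only i k = when (k ≟ i) (f k)

  sumFin-only : ∀ i → sumFin n (only i) ≡ f i
  sumFin-only i = trans (sumFin-single n i (λ k → when-no (k ≟ i))) (when-yes (i ≟ i) refl)

  both≤f : ∀ k → only i k + only i′ k ≤ f k
  both≤f k with k ≟ i | k ≟ i′
  ... | yes refl | yes refl = ⊥-elim (i≢i′ refl)
  ... | yes _    | no  _    = ℚP.≤-reflexive (ℚP.+-identityʳ (f k))
  ... | no  _    | yes _    = ℚP.≤-reflexive (ℚP.+-identityˡ (f k))
  ... | no  _    | no  _    = f≥0 k

sumFin-split : ∀ n (b : Fin n → Bool) (f : Fin n → ℚ) →
               sumFin n f ≡ sumFin n (λ i → if b i then f i else 0ℚ)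
                          + sumFin n (λ i → if b i then 0ℚ else f i)
sumFin-split n b f = begin
  sumFin n f                ≡⟨ sumFin≡sum n f ⟩
  sum f                     ≡⟨ sum-cong-≗ f≗in+out ⟩
  sum (λ i → in′ i + out i) ≡⟨ ∑-distrib-+ in′ out ⟩
  sum in′ + sum out         ≡⟨ sym (cong₂ _+_ (sumFin≡sum n in′) (sumFin≡sum n out)) ⟩
  sumFin n in′ + sumFin n out ∎
  where
  open ≡-Reasoning
  in′ out : Fin n → ℚ
  in′ i = if b i then f i else 0ℚ
  out i = if b i then 0ℚ else f i
  f≗in+out : ∀ i → f i ≡ in′ i + out i
  f≗in+out i with b i
  ... | true  = sym (ℚP.+-identityʳ (f i))
  ... | false = sym (ℚP.+-identityˡ (f i))

sumℕ-mono-≤ : ∀ {n} {s t : Fin n → ℕ} → (∀ i → s i ℕ.≤ t i) → sumℕ s ℕ.≤ sumℕ t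
sumℕ-mono-≤ {zero}  s≤t = ℕ.z≤n
sumℕ-mono-≤ {suc n} s≤t = ℕP.+-mono-≤ (s≤t zero) (sumℕ-mono-≤ (λ i → s≤t (suc i)))

sumℕ-mono-< : ∀ {n} {s t : Fin n → ℕ} → (∀ i → s i ℕ.≤ t i) → ∀ i → s i ℕ.< t i → sumℕ s ℕ.< sumℕ t
sumℕ-mono-< s≤t zero    s<t = ℕP.+-mono-<-≤ s<t (sumℕ-mono-≤ (λ i → s≤t (suc i)))
sumℕ-mono-< s≤t (suc i) s<t = ℕP.+-mono-≤-< (s≤t zero) (sumℕ-mono-< (λ i → s≤t (suc i)) i s<t)

module _ (I : Instance) where
  open Instance I

  Assigned : Assignment I → Fin nJ → Fin nM → Set
  Assigned x j m = 0ℚ < x j m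

  assigned? : ∀ x j m → Dec (Assigned x j m)
  assigned? x j m = 0ℚ ℚ.<? x j m

  posInExactlyOne? : ∀ x y j m → Dec (PosInExactlyOne I x y j m)
  posInExactlyOne? x y j m = (assigned? x j m ×-dec ¬? (assigned? y j m))
                       ⊎-dec (¬? (assigned? x j m) ×-dec assigned? y j m)

  qJ≥0 : ∀ j → 0ℚ ≤ qJ j
  qJ≥0 j = ℚP.<⇒≤ (qJ-pos j)

  stable⇒unsplit : ∀ {x} → Stable I x → Unsplit I x
  stable⇒unsplit x-stable = proj₁ (proj₁ x-stable)

  module _ {x : Assignment I} (x-unsplit : Unsplit I x) where

    unsplit-nonneg : ∀ j m → 0ℚ ≤ x j m
    unsplit-nonneg = proj₁ (proj₁ x-unsplit)

    unsplit-adj : ∀ {j m} → Assigned x j m → adj j m ≡ true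
    unsplit-adj {j} {m} jm with adj j m in eq
    ... | true  = refl
    ... | false = ⊥-elim (ℚP.<-irrefl (sym (proj₂ (proj₁ x-unsplit) j m eq)) jm)

    unsplit-value : ∀ {j m} → Assigned x j m → x j m ≡ qJ j
    unsplit-value {j} {m} jm with proj₁ (proj₂ x-unsplit) j m (unsplit-adj jm)
    ... | inj₁ x≡0 = ⊥-elim (ℚP.<-irrefl (sym x≡0) jm)
    ... | inj₂ x≡q = x≡q

    unsplit-zero : ∀ {j m} → ¬ Assigned x j m → x j m ≡ 0ℚ
    unsplit-zero {j} {m} ¬jm = ℚP.≤-antisym (ℚP.≮⇒≥ ¬jm) (unsplit-nonneg j m)

    unsplit-unique : ∀ {j m m′} → Assigned x j m → Assigned x j m′ → m ≡ m′
    unsplit-unique {j} {m} {m′} jm jm′ with m ≟ m′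
    ... | yes m≡m′ = m≡m′
    ... | no  m≢m′ = ⊥-elim (ℚP.<-irrefl refl (begin-strict
      qJ j               ≡⟨ sym (ℚP.+-identityʳ (qJ j)) ⟩
      qJ j + 0ℚ          <⟨ ℚP.+-monoʳ-< (qJ j) (qJ-pos j) ⟩
      qJ j + qJ j        ≡⟨ sym (cong₂ _+_ (unsplit-value jm) (unsplit-value jm′)) ⟩
      x j m + x j m′     ≤⟨ sumFin-≥-pair nM (unsplit-nonneg j) m≢m′ ⟩
      loadJ I x j        ≤⟨ proj₂ (proj₂ x-unsplit) j ⟩
      qJ j               ∎))
      where open ℚP.≤-Reasoning

  assigned⊆⇒≤ : ∀ {x y j m} → Unsplit I x → Unsplit I y →
                (Assigned x j m → Assigned y j m) → x j m ≤ y j m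
  assigned⊆⇒≤ {x} {y} {j} {m} x-unsplit y-unsplit x⊆y with assigned? x j m
  ... | yes jm = ℚP.≤-reflexive (trans (unsplit-value x-unsplit jm)
                                       (sym (unsplit-value y-unsplit (x⊆y jm))))
  ... | no ¬jm = subst (_≤ y j m) (sym (unsplit-zero x-unsplit ¬jm))
                       (unsplit-nonneg y-unsplit j m)

  loadM-mono-⊆ : ∀ {x y m} → Unsplit I x → Unsplit I y →
                 (∀ k → Assigned x k m → Assigned y k m) → loadM I x m ≤ loadM I y m
  loadM-mono-⊆ x-unsplit y-unsplit x⊆y =
    sumFin-mono nJ (λ k → assigned⊆⇒≤ x-unsplit y-unsplit (x⊆y k))

  betterLoad-mono-above : ∀ {x y m j} → (∀ k → rankM m k ℕ.< rankM m j → x k m ≤ y k m) →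
                          betterLoad I x m j ≤ betterLoad I y m j
  betterLoad-mono-above {x} {y} {m} {j} x≤y = sumFin-mono nJ term-mono
    where
    term-mono : ∀ k → (if rankM m k ℕ.<ᵇ rankM m j then x k m else 0ℚ)
                    ≤ (if rankM m k ℕ.<ᵇ rankM m j then y k m else 0ℚ)
    term-mono k with rankM m k ℕ.<ᵇ rankM m j | ℕP.<ᵇ-reflects-< (rankM m k) (rankM m j)
    ... | true  | ofʸ k<j = x≤y k k<j
    ... | false | _       = ℚP.≤-refl

  betterLoad-monoʳ : ∀ {x m j j′} → (∀ k → 0ℚ ≤ x k m) → rankM m j ℕ.≤ rankM m j′ →
                     betterLoad I x m j ≤ betterLoad I x m j′
  betterLoad-monoʳ {x} {m} {j} {j′} x≥0 j≤j′ = sumFin-mono nJ term-mono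
    where
    term-mono : ∀ k → (if rankM m k ℕ.<ᵇ rankM m j then x k m else 0ℚ)
                    ≤ (if rankM m k ℕ.<ᵇ rankM m j′ then x k m else 0ℚ)
    term-mono k with rankM m k ℕ.<ᵇ rankM m j  | ℕP.<ᵇ-reflects-< (rankM m k) (rankM m j)
                   | rankM m k ℕ.<ᵇ rankM m j′ | ℕP.<ᵇ-reflects-< (rankM m k) (rankM m j′)
    ... | true  | _       | true  | _        = ℚP.≤-refl
    ... | true  | ofʸ k<j | false | ofⁿ k≮j′ = ⊥-elim (k≮j′ (ℕP.<-≤-trans k<j j≤j′))
    ... | false | _       | true  | _        = x≥0 k
    ... | false | _       | false | _        = ℚP.≤-refl

  betterLoad≤loadM : ∀ {x m j} → (∀ k → 0ℚ ≤ x k m) → betterLoad I x m j ≤ loadM I x m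
  betterLoad≤loadM {x} {m} {j} x≥0 = sumFin-mono nJ term≤
    where
    term≤ : ∀ k → (if rankM m k ℕ.<ᵇ rankM m j then x k m else 0ℚ) ≤ x k m
    term≤ k with rankM m k ℕ.<ᵇ rankM m j
    ... | true  = ℚP.≤-refl
    ... | false = x≥0 k

  -- Only the least preferred job j escapes betterLoad x m j.
  loadM-minus-worst : ∀ {x m j} → Unsplit I x → Assigned x j m →
                      (∀ k → Assigned x k m → rankM m k ℕ.≤ rankM m j) →
                      loadM I x m - qJ j ≡ betterLoad I x m j
  loadM-minus-worst {x} {m} {j} x-unsplit jm worst = begin
    loadM I x m - qJ j                          ≡⟨ cong (_- qJ j) (sumFin-split nJ better (λ k → x k m)) ⟩
    betterLoad I x m j + sumFin nJ rest - qJ j  ≡⟨ cong (λ r → betterLoad I x m j + r - qJ j) rest≡q ⟩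
    betterLoad I x m j + qJ j - qJ j            ≡⟨ //-rightDividesʳ (qJ j) (betterLoad I x m j) ⟩
    betterLoad I x m j                          ∎
    where
    open ≡-Reasoning
    better : Fin nJ → Bool
    better k = rankM m k ℕ.<ᵇ rankM m j
    rest : Fin nJ → ℚ
    rest k = if better k then 0ℚ else x k m
    vanish : ∀ k → k ≢ j → rest k ≡ 0ℚ
    vanish k k≢j with better k | ℕP.<ᵇ-reflects-< (rankM m k) (rankM m j)
    ... | true  | _        = refl
    ... | false | ofⁿ k≮j  = unsplit-zero x-unsplit λ km →
      k≢j (rankM-inj m k j (unsplit-adj x-unsplit km) (unsplit-adj x-unsplit jm)
                           (ℕP.≤-antisym (worst k km) (ℕP.≮⇒≥ k≮j)))
    rest-j : rest j ≡ qJ j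
    rest-j with better j | ℕP.<ᵇ-reflects-< (rankM m j) (rankM m j)
    ... | true  | ofʸ j<j = ⊥-elim (ℕP.<-irrefl refl j<j)
    ... | false | _       = unsplit-value x-unsplit jm
    rest≡q : sumFin nJ rest ≡ qJ j
    rest≡q = trans (sumFin-single nJ j vanish) rest-j

  relaxed⇒betterLoad<qM : ∀ {y m j} → RelaxedUnsplit I y → Assigned y j m →
                          betterLoad I y m j < qM m
  relaxed⇒betterLoad<qM {y} {m} {j} (y-unsplit , relaxed) jm
    with maximiser (λ k → assigned? y k m) (rankM m) jm
  ... | w , wm , worst = begin-strict
    betterLoad I y m j   ≤⟨ betterLoad-monoʳ {y} (λ k → unsplit-nonneg y-unsplit k m) (worst j jm) ⟩
    betterLoad I y m w   ≡⟨ sym (loadM-minus-worst y-unsplit wm worst) ⟩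
    loadM I y m - qJ w   <⟨ relaxed m w wm worst ⟩
    qM m                 ∎
    where open ℚP.≤-Reasoning

  stable⇒saturated : ∀ {x j m} → Stable I x → adj j m ≡ true → ¬ Assigned x j m →
                     (∀ m′ → Assigned x j m′ → rankJ j m ℕ.≤ rankJ j m′) →
                     qM m ≤ betterLoad I x m j
  stable⇒saturated {x} {j} {m} (x-relaxed , no-blocking) jm-adj ¬jm no-better
    with no-blocking j m jm-adj (unsplit-zero (proj₁ x-relaxed) ¬jm)
  ... | inj₁ (m′ , jm′ , m′<m) = ⊥-elim (ℕP.<⇒≱ m′<m (no-better m′ jm′))
  ... | inj₂ saturated        = saturated

  underCapacity⇒assigned⊆ : ∀ {x y m} → Unsplit I y → Stable I x → loadM I x m < qM m →
                            (∀ k → Assigned y k m → JobWeaklyPrefers I y x k) →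
                            ∀ k → Assigned y k m → Assigned x k m
  underCapacity⇒assigned⊆ {x} {y} {m} y-unsplit x-stable x<q prefers k km
    with assigned? x k m
  ... | yes km′ = km′
  ... | no ¬km′ = ⊥-elim (ℚP.<-irrefl refl (begin-strict
    qM m                ≤⟨ stable⇒saturated x-stable (unsplit-adj y-unsplit km) ¬km′
                             (λ m′ → prefers k km m m′ km) ⟩
    betterLoad I x m k  ≤⟨ betterLoad≤loadM {x} (λ k′ → unsplit-nonneg (stable⇒unsplit x-stable) k′ m) ⟩
    loadM I x m         <⟨ x<q ⟩
    qM m                ∎))
    where open ℚP.≤-Reasoning

  preferred⇒assigned⊇ : ∀ {x y m} → RelaxedUnsplit I y → Stable I x →
                        MachineWeaklyPrefers I y x m → (∀ k → JobWeaklyPrefers I y x k) →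
                        ∀ k → Assigned x k m → Assigned y k m
  preferred⇒assigned⊇ {x} {y} {m} y-relaxed x-stable m-prefers k-prefers k km
    with assigned? y k m
  ... | yes km′ = km′
  ... | no ¬km′ with minimiser (λ k′ → posInExactlyOne? y x k′ m) (rankM m) (inj₂ (¬km′ , km))
  ...   | k₀ , k₀-differs , k₀-first = ⊥-elim (ℚP.<-irrefl refl (begin-strict
    qM m                 ≤⟨ stable⇒saturated x-stable (unsplit-adj y-unsplit y-k₀) ¬x-k₀
                              (λ m′ → k-prefers k₀ m m′ y-k₀) ⟩
    betterLoad I x m k₀  ≤⟨ betterLoad-mono-above {x} {y} agree-above ⟩
    betterLoad I y m k₀  <⟨ relaxed⇒betterLoad<qM y-relaxed y-k₀ ⟩
    qM m                 ∎))
    where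
    open ℚP.≤-Reasoning
    y-unsplit : Unsplit I y
    y-unsplit = proj₁ y-relaxed
    x-unsplit : Unsplit I x
    x-unsplit = stable⇒unsplit x-stable
    y-k₀ : Assigned y k₀ m
    y-k₀ = m-prefers k₀ k₀-differs k₀-first
    ¬x-k₀ : ¬ Assigned x k₀ m
    ¬x-k₀ = [ proj₂ , (λ only-x → ⊥-elim (proj₁ only-x y-k₀)) ]′ k₀-differs
    agree-above : ∀ k′ → rankM m k′ ℕ.< rankM m k₀ → x k′ m ≤ y k′ m
    agree-above k′ k′<k₀ = assigned⊆⇒≤ x-unsplit y-unsplit λ x-k′ →
      decidable-stable (assigned? y k′ m) λ ¬y-k′ →
        ℕP.<⇒≱ k′<k₀ (k₀-first k′ (inj₂ (¬y-k′ , x-k′)))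

  JobPessimal : Assignment I → Set
  JobPessimal w = Stable I w × (∀ x → Stable I x → ∀ j → JobWeaklyPrefers I x w j)

  -- Job j has rejected exactly the machines it ranks worse than its threshold
  -- t j; machine m proposes to an open job j unless the open jobs m prefers to
  -- j already fill q(m).
  module DeferredAcceptance where

    Thresholds : Set
    Thresholds = Fin nJ → ℕ

    IsOpen : Thresholds → Fin nJ → Fin nM → Set
    IsOpen t j m = adj j m ≡ true × rankJ j m ℕ.≤ t j

    open? : ∀ t j m → Dec (IsOpen t j m)
    open? t j m = (adj j m Bool.≟ true) ×-dec (rankJ j m ℕ.≤? t j)

    openAssignment : Thresholds → Assignment I
    openAssignment t j m = when (open? t j m) (qJ j)

    Proposes : Thresholds → Fin nJ → Fin nM → Set
    Proposes t j m = IsOpen t j m × betterLoad I (openAssignment t) m j < qM m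

    proposes? : ∀ t j m → Dec (Proposes t j m)
    proposes? t j m = open? t j m ×-dec (betterLoad I (openAssignment t) m j ℚ.<? qM m)

    proposals : Thresholds → Assignment I
    proposals t j m = when (proposes? t j m) (qJ j)

    HoldsProposal : Thresholds → Set
    HoldsProposal t = ∀ j → ∃[ m ] (Proposes t j m × rankJ j m ≡ t j)

    KeepsStablePartners : Thresholds → Set
    KeepsStablePartners t = ∀ x → Stable I x → ∀ j m → Assigned x j m → rankJ j m ℕ.≤ t j

    Conflict : Thresholds → Set
    Conflict t = ∃[ j ] ∃[ m ] ∃[ m′ ] (Proposes t j m × Proposes t j m′ × rankJ j m ℕ.< rankJ j m′)

    conflict? : ∀ t → Dec (Conflict t)
    conflict? t = any? λ j → any? λ m → any? λ m′ →
      proposes? t j m ×-dec proposes? t j m′ ×-dec rankJ j m ℕ.<? rankJ j m′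

    openAssignment-antitone : ∀ {t t′} → (∀ k → t′ k ℕ.≤ t k) →
                              ∀ j m → openAssignment t′ j m ≤ openAssignment t j m
    openAssignment-antitone {t} {t′} t′≤t j m =
      when-mono (open? t′ j m) (open? t j m)
                (λ (jm , m≤t′) → jm , ℕP.≤-trans m≤t′ (t′≤t j)) (qJ≥0 j)

    proposal-persists : ∀ {t t′ j m} → (∀ k → t′ k ℕ.≤ t k) → rankJ j m ℕ.≤ t′ j →
                        Proposes t j m → Proposes t′ j m
    proposal-persists {t} {t′} t′≤t m≤t′ ((jm , _) , load<q) =
      (jm , m≤t′) ,
      ℚP.≤-<-trans (betterLoad-mono-above {openAssignment t′} {openAssignment t}
                      (λ k _ → openAssignment-antitone t′≤t k _))
                   load<q

    module _ {t : Thresholds} (keeps : KeepsStablePartners t) {x : Assignment I} (x-stable : Stable I x) where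

      private
        x-unsplit : Unsplit I x
        x-unsplit = stable⇒unsplit x-stable

      stable≤openAssignment : ∀ j m → x j m ≤ openAssignment t j m
      stable≤openAssignment j m with assigned? x j m
      ... | yes jm = ℚP.≤-reflexive (trans (unsplit-value x-unsplit jm)
                       (sym (when-yes (open? t j m) (unsplit-adj x-unsplit jm , keeps x x-stable j m jm))))
      ... | no ¬jm = subst (_≤ openAssignment t j m) (sym (unsplit-zero x-unsplit ¬jm))
                           (when-nonneg (open? t j m) (qJ≥0 j))

      -- If j preferred the proposer m′ to its partner m, then m′ would be
      -- saturated in x by jobs that are all still open to it.
      stablePartner-≤-proposer : ∀ {j m m′} → Assigned x j m → Proposes t j m′ →
                                 rankJ j m ℕ.≤ rankJ j m′
      stablePartner-≤-proposer {j} {m} {m′} jm ((jm′-adj , _) , load<q) = ℕP.≮⇒≥ λ m′<m →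
        ℚP.<-irrefl refl (begin-strict
          qM m′                                 ≤⟨ stable⇒saturated x-stable jm′-adj (¬jm′ m′<m) (m′≤partner m′<m) ⟩
          betterLoad I x m′ j                   ≤⟨ betterLoad-mono-above {x} {openAssignment t}
                                                     (λ k _ → stable≤openAssignment k m′) ⟩
          betterLoad I (openAssignment t) m′ j  <⟨ load<q ⟩
          qM m′                                 ∎)
        where
        open ℚP.≤-Reasoning
        ¬jm′ : rankJ j m′ ℕ.< rankJ j m → ¬ Assigned x j m′
        ¬jm′ m′<m jm′ = ℕP.<-irrefl (cong (rankJ j) (unsplit-unique x-unsplit jm′ jm)) m′<m
        m′≤partner : rankJ j m′ ℕ.< rankJ j m → ∀ m″ → Assigned x j m″ → rankJ j m′ ℕ.≤ rankJ j m″
        m′≤partner m′<m m″ jm″ with unsplit-unique x-unsplit jm jm″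
        ... | refl = ℕP.<⇒≤ m′<m

    proposals-proposes : ∀ {t j m} → Assigned (proposals t) j m → Proposes t j m
    proposals-proposes {t} {j} {m} = when-pos⇒ (proposes? t j m)

    proposes⇒assigned : ∀ {t j m} → Proposes t j m → Assigned (proposals t) j m
    proposes⇒assigned {t} {j} {m} p = subst (0ℚ <_) (sym (when-yes (proposes? t j m) p)) (qJ-pos j)

    proposals≤openAssignment : ∀ t j m → proposals t j m ≤ openAssignment t j m
    proposals≤openAssignment t j m = when-mono (proposes? t j m) (open? t j m) proj₁ (qJ≥0 j)

    -- Among the open jobs m does not propose to, the one m likes best sees
    -- only proposed-to jobs above it, and these already fill q(m).
    unproposed⇒saturated : ∀ {t j m} → IsOpen t j m → ¬ Proposes t j m →
                           qM m ≤ betterLoad I (proposals t) m j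
    unproposed⇒saturated {t} {j} {m} open-jm ¬proposes
      with minimiser (λ k → open? t k m ×-dec ¬? (proposes? t k m)) (rankM m) (open-jm , ¬proposes)
    ... | k₀ , (open-k₀ , ¬proposes-k₀) , k₀-first = begin
      qM m                                  ≤⟨ ℚP.≮⇒≥ (λ load<q → ¬proposes-k₀ (open-k₀ , load<q)) ⟩
      betterLoad I (openAssignment t) m k₀  ≤⟨ betterLoad-mono-above {openAssignment t} {proposals t}
                                                 open≤proposals ⟩
      betterLoad I (proposals t) m k₀       ≤⟨ betterLoad-monoʳ {proposals t}
                                                 (λ k → when-nonneg (proposes? t k m) (qJ≥0 k))
                                                 (k₀-first j (open-jm , ¬proposes)) ⟩
      betterLoad I (proposals t) m j        ∎
      where
      open ℚP.≤-Reasoning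
      open≤proposals : ∀ k → rankM m k ℕ.< rankM m k₀ → openAssignment t k m ≤ proposals t k m
      open≤proposals k k<k₀ = when-mono (open? t k m) (proposes? t k m)
        (λ open-k → decidable-stable (proposes? t k m) λ ¬proposes-k →
                      ℕP.<⇒≱ k<k₀ (k₀-first k (open-k , ¬proposes-k)))
        (qJ≥0 k)

    module Settled {t : Thresholds} (holds : HoldsProposal t) (settled : ¬ Conflict t) where

      proposals-unique : ∀ {j m m′} → Proposes t j m → Proposes t j m′ → m ≡ m′
      proposals-unique {j} {m} {m′} p p′ with ℕP.<-cmp (rankJ j m) (rankJ j m′)
      ... | tri< m<m′ _ _ = ⊥-elim (settled (j , m , m′ , p , p′ , m<m′))
      ... | tri≈ _ m≡m′ _ = rankJ-inj j m m′ (proj₁ (proj₁ p)) (proj₁ (proj₁ p′)) m≡m′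
      ... | tri> _ _ m′<m = ⊥-elim (settled (j , m′ , m , p′ , p , m′<m))

      proposals-unsplit : Unsplit I (proposals t)
      proposals-unsplit = (nonneg , off-edges) , values , loadJ≤q
        where
        nonneg : ∀ j m → 0ℚ ≤ proposals t j m
        nonneg j m = when-nonneg (proposes? t j m) (qJ≥0 j)
        off-edges : ∀ j m → adj j m ≡ false → proposals t j m ≡ 0ℚ
        off-edges j m ¬adj = when-no (proposes? t j m) λ ((jm-adj , _) , _) → case trans (sym jm-adj) ¬adj of λ ()
        values : ∀ j m → adj j m ≡ true → proposals t j m ≡ 0ℚ ⊎ proposals t j m ≡ qJ j
        values j m _ with proposes? t j m
        ... | yes p = inj₂ (when-yes (proposes? t j m) p)
        ... | no ¬p = inj₁ (when-no (proposes? t j m) ¬p)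
        loadJ≤q : ∀ j → loadJ I (proposals t) j ≤ qJ j
        loadJ≤q j with holds j
        ... | m₀ , p₀ , _ = ℚP.≤-reflexive (trans
          (sumFin-single nM m₀ λ m m≢m₀ → when-no (proposes? t j m) λ p → m≢m₀ (proposals-unique p p₀))
          (when-yes (proposes? t j m₀) p₀))

      proposals-stable : Stable I (proposals t)
      proposals-stable = (proposals-unsplit , relaxed) , unblocked
        where
        relaxed : ∀ m j → Assigned (proposals t) j m →
                  (∀ j′ → Assigned (proposals t) j′ m → rankM m j′ ℕ.≤ rankM m j) →
                  loadM I (proposals t) m - qJ j < qM m
        relaxed m j jm worst = begin-strict
          loadM I (proposals t) m - qJ j        ≡⟨ loadM-minus-worst proposals-unsplit jm worst ⟩
          betterLoad I (proposals t) m j        ≤⟨ betterLoad-mono-above {proposals t} {openAssignment t}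
                                                     (λ k _ → proposals≤openAssignment t k m) ⟩
          betterLoad I (openAssignment t) m j   <⟨ proj₂ (proposals-proposes jm) ⟩
          qM m                                  ∎
          where open ℚP.≤-Reasoning
        unblocked : ∀ j m → adj j m ≡ true → proposals t j m ≡ 0ℚ →
                    (∃[ m′ ] (Assigned (proposals t) j m′ × rankJ j m′ ℕ.< rankJ j m))
                    ⊎ (qM m ≤ betterLoad I (proposals t) m j)
        unblocked j m jm-adj jm≡0 with open? t j m | holds j
        ... | yes open-jm | _ = inj₂ (unproposed⇒saturated open-jm λ p →
                                  ℚP.<-irrefl (sym jm≡0) (proposes⇒assigned p))
        ... | no ¬open-jm | m₀ , p₀ , m₀≡t = inj₁ (m₀ , proposes⇒assigned p₀ ,
                                  subst (ℕ._< rankJ j m) (sym m₀≡t) (ℕP.≰⇒> λ m≤t → ¬open-jm (jm-adj , m≤t)))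

    proposals-pessimal : ∀ {t} → KeepsStablePartners t → ∀ x → Stable I x → ∀ j →
                         JobWeaklyPrefers I x (proposals t) j
    proposals-pessimal keeps x x-stable j m₁ m₂ jm₁ jm₂ =
      stablePartner-≤-proposer keeps x-stable jm₁ (proposals-proposes jm₂)

    resolve : ∀ {t} → HoldsProposal t → KeepsStablePartners t → Conflict t →
              ∃[ t′ ] (HoldsProposal t′ × KeepsStablePartners t′ × sumℕ t′ ℕ.< sumℕ t)
    resolve {t} holds keeps (j , m , m′ , p , p′ , m<m′) = t′ , holds′ , keeps′ , decreases
      where
      t′ : Thresholds
      t′ = updateAt t j (λ _ → rankJ j m)
      t′-j : t′ j ≡ rankJ j m
      t′-j = updateAt-updates j t
      t′-k : ∀ {k} → k ≢ j → t′ k ≡ t k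
      t′-k k≢j = updateAt-minimal _ j t k≢j
      m<t : rankJ j m ℕ.< t j
      m<t = ℕP.<-≤-trans m<m′ (proj₂ (proj₁ p′))
      t′≤t : ∀ k → t′ k ℕ.≤ t k
      t′≤t k with k ≟ j
      ... | yes refl = subst (ℕ._≤ t j) (sym t′-j) (ℕP.<⇒≤ m<t)
      ... | no  k≢j  = ℕP.≤-reflexive (t′-k k≢j)
      holds′ : HoldsProposal t′
      holds′ k with k ≟ j
      ... | yes refl = m , proposal-persists t′≤t (ℕP.≤-reflexive (sym t′-j)) p , sym t′-j
      ... | no  k≢j  with holds k
      ...   | mₖ , pₖ , mₖ≡t = mₖ , proposal-persists t′≤t (ℕP.≤-reflexive mₖ≡t′) pₖ , mₖ≡t′
        where
        mₖ≡t′ : rankJ k mₖ ≡ t′ k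
        mₖ≡t′ = trans mₖ≡t (sym (t′-k k≢j))
      keeps′ : KeepsStablePartners t′
      keeps′ x x-stable k m″ km″ with k ≟ j
      ... | yes refl = subst (rankJ j m″ ℕ.≤_) (sym t′-j) (stablePartner-≤-proposer keeps x-stable km″ p)
      ... | no  k≢j  = subst (rankJ k m″ ℕ.≤_) (sym (t′-k k≢j)) (keeps x x-stable k m″ km″)
      decreases : sumℕ t′ ℕ.< sumℕ t
      decreases = sumℕ-mono-< t′≤t j (subst (ℕ._< t j) (sym t′-j) m<t)

    settle : ∀ t → Acc (ℕ._<_ on sumℕ) t → HoldsProposal t → KeepsStablePartners t →
             ∃[ t ] (HoldsProposal t × KeepsStablePartners t × ¬ Conflict t)
    settle t (acc smaller) holds keeps with conflict? t
    ... | no  settled  = t , holds , keeps , settled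
    ... | yes conflict with resolve holds keeps conflict
    ...   | t′ , holds′ , keeps′ , t′<t = settle t′ (smaller t′<t) holds′ keeps′

    initial : Thresholds
    initial j = rankJ j md

    initial-holds : HoldsProposal initial
    initial-holds j = md , ((md-adj j , ℕP.≤-refl) , load<q) , refl
      where
      open ℚP.≤-Reasoning
      load<q : betterLoad I (openAssignment initial) md j < qM md
      load<q = begin-strict
        betterLoad I (openAssignment initial) md j  ≤⟨ betterLoad≤loadM {openAssignment initial}
                                                         (λ k → when-nonneg (open? initial k md) (qJ≥0 k)) ⟩
        loadM I (openAssignment initial) md         ≤⟨ sumFin-mono nJ (λ k → when-≤ (open? initial k md) (qJ≥0 k)) ⟩
        sumFin nJ qJ                                <⟨ md-cap ⟩
        qM md                                       ∎

    initial-keeps : KeepsStablePartners initial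
    initial-keeps x x-stable j m jm with m ≟ md
    ... | yes refl = ℕP.≤-refl
    ... | no  m≢md = ℕP.<⇒≤ (md-last j m (unsplit-adj (stable⇒unsplit x-stable) jm) m≢md)

    jobPessimal-exists : ∃[ w ] JobPessimal w
    jobPessimal-exists
      with settle initial (On.wellFounded sumℕ <-wellFounded initial) initial-holds initial-keeps
    ... | t , holds , keeps , settled =
      proposals t , Settled.proposals-stable holds settled , proposals-pessimal keeps

  open DeferredAcceptance public using (jobPessimal-exists)

  jobOptimal-overCapacity : ∀ {xj m} → JobOptimal I xj → qM m < loadM I xj m →
                            ∀ x → Stable I x → qM m ≤ loadM I x m
  jobOptimal-overCapacity {xj} {m} (xj-stable , xj-optimal) q<xj x x-stable
    with qM m ℚ.≤? loadM I x m
  ... | yes q≤x = q≤x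
  ... | no  q≰x = ⊥-elim (ℚP.<-asym q<xj (ℚP.≤-<-trans xj≤x x<q))
    where
    x<q : loadM I x m < qM m
    x<q = ℚP.≰⇒> q≰x
    xj≤x : loadM I xj m ≤ loadM I x m
    xj≤x = loadM-mono-⊆ (stable⇒unsplit xj-stable) (stable⇒unsplit x-stable)
             (underCapacity⇒assigned⊆ (stable⇒unsplit xj-stable) x-stable x<q
               (λ k _ → xj-optimal x x-stable k))

  machineOptimal-underCapacity : ∀ {w xm m} → JobPessimal w → MachineOptimal I xm →
                                 loadM I xm m < qM m → ∀ x → Stable I x → loadM I x m < qM m
  machineOptimal-underCapacity {w} {xm} {m} (w-stable , w-pessimal) (xm-stable , xm-optimal)
                               xm<q x x-stable = ℚP.≤-<-trans x≤w w<q
    where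
    w≤xm : loadM I w m ≤ loadM I xm m
    w≤xm = loadM-mono-⊆ (stable⇒unsplit w-stable) (stable⇒unsplit xm-stable)
             (preferred⇒assigned⊇ (proj₁ xm-stable) w-stable (xm-optimal w w-stable m)
               (w-pessimal xm xm-stable))
    w<q : loadM I w m < qM m
    w<q = ℚP.≤-<-trans w≤xm xm<q
    x≤w : loadM I x m ≤ loadM I w m
    x≤w = loadM-mono-⊆ (stable⇒unsplit x-stable) (stable⇒unsplit w-stable)
            (underCapacity⇒assigned⊆ (stable⇒unsplit x-stable) w-stable w<q
              (λ k _ → w-pessimal x x-stable k))

theorem5 : (I : Instance) → (xjopt xmopt : Assignment I) →
    JobOptimal I xjopt → MachineOptimal I xmopt →
    (m : Fin (Instance.nM I)) →
    (loadM I xmopt m < Instance.qM I m →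
       ∀ x → Stable I x → loadM I x m < Instance.qM I m)
    × (Instance.qM I m < loadM I xjopt m →
       ∀ x → Stable I x → Instance.qM I m ≤ loadM I x m)
theorem5 I xjopt xmopt jopt mopt m =
  machineOptimal-underCapacity I (proj₂ (jobPessimal-exists I)) mopt ,
  jobOptimal-overCapacity I jopt
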